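{- Let $\mathbf P$ be a matroid property stable under isomorphism. (1) If $\mathbf P$ is deletion closed and every matroid satisfying $\mathbf P$ is loopless, then $(\mathcal M^{\mathbf P,\mathrm{disc}}_\bullet,\partial_{\mathrm{del}})$ is a subcomplex of $(\mathcal M_\bullet,\partial_{\mathrm{del}})$. (2) If $\mathbf P$ is contraction closed and every matroid satisfying $\mathbf P$ is coloopless, then $(\mathcal M^{\mathbf P,\mathrm{disc}}_\bullet,\partial_{\mathrm{con}})$ is a subcomplex of $(\mathcal M_\bullet,\partial_{\mathrm{con}})$.
   Context: A matroid is connected if it is nonempty and not a direct sum of two nonempty matroids; a nonempty matroid that is not connected is disconnected. An orientation of $\mathsf M$ is a generator $\eta$ of $\bigwedge^{|E|}\mathbb{Z}\langle E\rangle$, $E=E(\mathsf M)$. $\mathcal M$ is the $\mathbb{Q}$-vector space spanned by symbols $[\mathsf M,\eta]$ modulo $[\mathsf M,-\eta]=-[\mathsf M,\eta]$ and $[\mathsf M,\eta]=[\mathsf M',\psi_*\eta]$ for every matroid isomorphism $\psi:\mathsf M\to\mathsf M'$ ($\psi_*$ the induced map on top exterior powers), graded by ground-set size ($\mathcal M_\bullet$). With $\iota_x$ interior product: $\partial_{\mathrm{del}}[\mathsf M,\eta]=\sum_{x\text{ not a coloop}}[\mathsf M\setminus x,\iota_x\eta]$, $\partial_{\mathrm{con}}[\mathsf M,\eta]=\sum_{x\text{ not a loop}}[\mathsf M/x,\iota_x\eta]$. For $\mathbf P$ stable under isomorphism, $\mathcal M^{\mathbf P,\mathrm{disc}}_\bullet$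 is the span of classes $[\mathsf M,\eta]$ with $\mathsf M$ disconnected and having $\mathbf P$. Deletion closed (resp. contraction closed) means $\mathsf M\setminus x$ (resp. $\mathsf M/x$) has $\mathbf P$ whenever $\mathsf M$ does, for all $x\in E(\mathsf M)$. -}

module Defs where

open import Data.Nat as ℕ using (ℕ; zero; suc; _<_)
open import Data.Nat.Properties using (_<?_)
open import Data.Fin using (Fin; toℕ)
open import Data.Fin.Subset using (Subset; ⁅_⁆; _∪_; _∩_; ∁; ∣_∣; _∈_; _∉_; _⊆_; ⊥)
open import Data.Fin.Permutation using (Permutation; _⟨$⟩ʳ_; _⟨$⟩ˡ_)
open import Data.Bool using (Bool; true; false; _∧_; _∨_; not; if_then_else_)
open import Data.Vec using (Vec; []; _∷_; insertAt; tabulate; lookup)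
open import Data.List as List using (List; []; _∷_; _++_; concatMap; filter; allFin)
open import Data.Bool.ListAction using (all)
open import Data.List.Relation.Unary.All using (All)
open import Data.Sign using (Sign; opposite) renaming (_*_ to _*ˢ_)
import Data.Sign as Sign
open import Data.Rational as ℚ using (ℚ; 0ℚ; 1ℚ; -_) renaming (_+_ to _+ℚ_; _*_ to _*ℚ_)
open import Data.Product using (Σ; ∃; ∃-syntax; _×_; _,_)
open import Relation.Binary.PropositionalEquality using (_≡_)
open import Relation.Nullary using (¬_)
open import Relation.Nullary.Decidable using (⌊_⌋)

-- Raw set systems on the ground set Fin n, given by a (Boolean)
-- independence predicate on subsets.  A matroid is a raw set system
-- satisfying the independence axioms.  (Every finite matroid is
-- isomorphic to one on some Fin n.)

RawM : ℕ → Set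
RawM n = Subset n → Bool

Indep : ∀ {n} → RawM n → Subset n → Set
Indep M A = M A ≡ true

record IsMatroid {n : ℕ} (M : RawM n) : Set where
  field
    indep-∅    : Indep M ⊥
    indep-down : ∀ A B → B ⊆ A → Indep M A → Indep M B
    indep-aug  : ∀ A B → Indep M A → Indep M B → ∣ A ∣ < ∣ B ∣ →
                 ∃[ x ] (x ∈ B × x ∉ A × Indep M (A ∪ ⁅ x ⁆))

allSubsets : ∀ n → List (Subset n)
allSubsets zero    = [] ∷ []
allSubsets (suc n) = List.map (true ∷_) (allSubsets n) ++ List.map (false ∷_) (allSubsets n)

isBasis : ∀ {n} → RawM n → Subset n → Bool
isBasis M B = M B ∧ all (λ y → lookup B y ∨ not (M (B ∪ ⁅ y ⁆))) (allFin _)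

isLoop : ∀ {n} → RawM n → Fin n → Bool
isLoop M x = not (M ⁅ x ⁆)

isColoop : ∀ {n} → RawM n → Fin n → Bool
isColoop M x = all (λ B → not (isBasis M B) ∨ lookup B x) (allSubsets _)

Loopless : ∀ {n} → RawM n → Set
Loopless M = ∀ x → isLoop M x ≡ false

Coloopless : ∀ {n} → RawM n → Set
Coloopless M = ∀ x → isColoop M x ≡ false

-- Deletion and contraction; the ground set E ∖ {x} is identified with
-- Fin n in the order-preserving way (punching out x).

delete : ∀ {n} → RawM (suc n) → Fin (suc n) → RawM n
delete M x A = M (insertAt A x false)

contract : ∀ {n} → RawM (suc n) → Fin (suc n) → RawM n
contract M x A = if isLoop M x then M (insertAt A x false) else M (insertAt A x true)

image : ∀ {n n'} → Permutation n n' → Subset n → Subset n'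
image σ A = tabulate (λ j → lookup A (σ ⟨$⟩ˡ j))

IsIso : ∀ {n n'} → RawM n → RawM n' → Permutation n n' → Set
IsIso M M' σ = ∀ A → M' (image σ A) ≡ M A

splitL : ∀ {a b} → Subset (a ℕ.+ b) → Subset a
splitL {zero}  _       = []
splitL {suc a} (s ∷ A) = s ∷ splitL {a} A

splitR : ∀ {a b} → Subset (a ℕ.+ b) → Subset b
splitR {zero}  A       = A
splitR {suc a} (s ∷ A) = splitR {a} A

directSum : ∀ {a b} → RawM a → RawM b → RawM (a ℕ.+ b)
directSum {a} {b} N₁ N₂ A = N₁ (splitL {a} {b} A) ∧ N₂ (splitR {a} {b} A)

Disconnected : ∀ {n} → RawM n → Set
Disconnected {n} M =
  Σ ℕ λ a → Σ ℕ λ b → Σ (RawM (suc a)) λ N₁ → Σ (RawM (suc b)) λ N₂ →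
    IsMatroid N₁ × IsMatroid N₂ ×
    Σ (Permutation n (suc a ℕ.+ suc b)) λ σ → IsIso M (directSum N₁ N₂) σ

-- The top exterior power of ℤ⟨Fin n⟩ is free of rank 1 on
-- e₀ ∧ ⋯ ∧ e_{n-1}; its two generators are ± that element, recorded by a
-- Sign.  ψ_* multiplies by the sign of the permutation ψ, and the
-- interior product ι_x sends e₀∧⋯∧e_{n-1} to (-1)^x e₀∧⋯ê_x⋯∧e_{n-1}.

Orientation : ℕ → Set
Orientation _ = Sign

parity : ℕ → Sign
parity zero    = Sign.+
parity (suc k) = opposite (parity k)

inversions : ∀ {n n'} → Permutation n n' → ℕ
inversions {n} σ = List.length
  (filter (λ ij → ( toℕ (Data.Product.proj₁ ij) <? toℕ (Data.Product.proj₂ ij))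
                  Relation.Nullary.Decidable.×-dec
                  ( toℕ (σ ⟨$⟩ʳ Data.Product.proj₂ ij) <? toℕ (σ ⟨$⟩ʳ Data.Product.proj₁ ij)))
          (List.cartesianProduct (allFin n) (allFin n)))
  where import Data.Product

signPerm : ∀ {n n'} → Permutation n n' → Sign
signPerm σ = parity (inversions σ)

push : ∀ {n n'} → Permutation n n' → Orientation n → Orientation n'
push σ η = signPerm σ *ˢ η

interior : ∀ {n} → Fin (suc n) → Orientation (suc n) → Orientation n
interior x η = parity (toℕ x) *ˢ η

-- The space 𝓜: formal ℚ-linear combinations of symbols [M, η], modulo
-- the congruence generated by the free-vector-space laws and the
-- relations [M,-η] = -[M,η], [M,η] = [M',ψ_*η].

record Gen : Set where
  constructor ⟦_,_⟧
  field
    {size} : ℕ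
    mat    : RawM size
    ori    : Orientation size

FSum : Set
FSum = List (ℚ × Gen)

infix 4 _≈_
data _≈_ : FSum → FSum → Set where
  ≈-refl  : ∀ {u} → u ≈ u
  ≈-sym   : ∀ {u v} → u ≈ v → v ≈ u
  ≈-trans : ∀ {u v w} → u ≈ v → v ≈ w → u ≈ w
  ≈-++    : ∀ {u u' v v'} → u ≈ u' → v ≈ v' → u ++ v ≈ u' ++ v'
  ≈-comm  : ∀ u v → u ++ v ≈ v ++ u
  ≈-add   : ∀ q r g → (q , g) ∷ (r , g) ∷ [] ≈ (q +ℚ r , g) ∷ []
  ≈-zero  : ∀ g → (0ℚ , g) ∷ [] ≈ []
  ≈-neg   : ∀ {n} q (M : RawM n) η → IsMatroid M →
            (q , ⟦ M , opposite η ⟧) ∷ [] ≈ (- q , ⟦ M , η ⟧) ∷ []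
  ≈-iso   : ∀ {n n'} q (M : RawM n) (M' : RawM n') η (ψ : Permutation n n') →
            IsMatroid M → IsIso M M' ψ →
            (q , ⟦ M , η ⟧) ∷ [] ≈ (q , ⟦ M' , push ψ η ⟧) ∷ []

scale : ℚ → FSum → FSum
scale q = List.map (λ { (r , g) → (q *ℚ r , g) })

∂del-gen : Gen → FSum
∂del-gen (⟦_,_⟧ {zero}  M η) = []
∂del-gen (⟦_,_⟧ {suc n} M η) =
  List.map (λ x → (1ℚ , ⟦ delete M x , interior x η ⟧))
           (filter (λ x → not (isColoop M x) Data.Bool.≟ true) (allFin (suc n)))
  where import Data.Bool

∂con-gen : Gen → FSum
∂con-gen (⟦_,_⟧ {zero}  M η) = []
∂con-gen (⟦_,_⟧ {suc n} M η) =
  List.map (λ x → (1ℚ , ⟦ contract M x , interior x η ⟧))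
           (filter (λ x → not (isLoop M x) Data.Bool.≟ true) (allFin (suc n)))
  where import Data.Bool

∂del : FSum → FSum
∂del = concatMap (λ { (q , g) → scale q (∂del-gen g) })

∂con : FSum → FSum
∂con = concatMap (λ { (q , g) → scale q (∂con-gen g) })

Property : Set₁
Property = ∀ {n} → RawM n → Set

StableUnderIso : Property → Set
StableUnderIso P = ∀ {n n'} (M : RawM n) (M' : RawM n') (ψ : Permutation n n') →
  IsMatroid M → IsIso M M' ψ → P M → P M'

DeletionClosed : Property → Set
DeletionClosed P = ∀ {n} (M : RawM (suc n)) x → IsMatroid M → P M → P (delete M x)

ContractionClosed : Property → Set
ContractionClosed P = ∀ {n} (M : RawM (suc n)) x → IsMatroid M → P M → P (contract M x)

DiscGen : Property → ℚ × Gen → Set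
DiscGen P (_ , ⟦ M , _ ⟧) = IsMatroid M × Disconnected M × P M

PureDisc : Property → FSum → Set
PureDisc P = All (DiscGen P)

InDisc : Property → FSum → Set
InDisc P v = ∃[ u ] (PureDisc P u × v ≈ u)

{-# OPTIONS --safe #-}
-- Deleting or contracting an element y of the summand N₁ of M ≅ N₁ ⊕ N₂ gives
-- (N₁ ∖ y) ⊕ N₂ resp. (N₁ / y) ⊕ N₂, which is disconnected again unless N₁ = {y};
-- and in that case y is a loop or a coloop of M.  The terms of ∂del skip coloops
-- and those of ∂con skip loops, while the hypotheses exclude loops resp. coloops
-- of matroids with P, so ∂ maps every disconnected generator with P to a sum of
-- such generators.
module Submission where

open import Defs
open import Data.Bool using (Bool; true; false; _∧_; _∨_; not; T; if_then_else_; _≟_)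
open import Data.Bool.Properties
  using (∨-identityʳ; ∨-zeroʳ; ∧-conicalˡ; ∧-conicalʳ; not-injective; T-≡)
open import Data.Empty using (⊥-elim)
open import Data.Fin using (Fin; zero; suc; punchIn; _↑ˡ_; _↑ʳ_; splitAt; join)
open import Data.Fin.Properties using (punchIn-punchOut; join-splitAt)
open import Data.Fin.Permutation using (Permutation; _⟨$⟩ʳ_; _⟨$⟩ˡ_; remove; inverseˡ; _∘ₚ_; cast-id)
import Data.Fin.Permutation as Perm
open import Data.Fin.Subset using (Subset; ⁅_⁆; _∪_; ∣_∣; _∈_; _∉_; _⊆_; ⊥)
open import Data.Fin.Subset.Properties using (∪-identityʳ; ⊆-min; s⊆s; drop-∷-⊆; drop-there)
open import Data.List using (allFin; concatMap)
open import Data.List.Membership.Propositional.Properties using (∈-allFin)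
import Data.List.Relation.Unary.All as All
open import Data.List.Relation.Unary.All.Properties using (map⁺; concat⁺; all-filter; all⁺; all⁻)
open import Data.Nat using (ℕ; zero; suc; pred; _+_; _<_; s≤s)
open import Data.Nat.Properties using (+-suc)
open import Data.Product using (_×_; _,_; ∃-syntax)
open import Data.Rational using (ℚ; 1ℚ)
open import Data.Sum using (inj₁; inj₂)
open import Data.Vec using (Vec; []; _∷_; insertAt; removeAt; lookup; cast; here; there)
open import Data.Vec.Properties
  using (insertAt-lookup; insertAt-punchIn; insertAt-removeAt; lookup∘tabulate; tabulate∘lookup;
         lookup-replicate; lookup-cast₁; cast-is-id)
open import Data.Vec.Relation.Binary.Pointwise.Extensional using (ext; Pointwise-≡⇒≡)
open import Function using (_∘_; Equivalence)
open import Relation.Binary.PropositionalEquality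
open import Relation.Nullary using (¬_)

open ≡-Reasoning

private variable
  a b n m : ℕ

insertAt-unique : {X : Set} (V : Vec X (suc n)) (W : Vec X n) (i : Fin (suc n)) (v : X) →
  lookup V i ≡ v → (∀ j → lookup V (punchIn i j) ≡ lookup W j) → V ≡ insertAt W i v
insertAt-unique (_ ∷ V) W zero v at-i off-i = cong₂ _∷_ at-i (Pointwise-≡⇒≡ (ext off-i))
insertAt-unique {suc n} (_ ∷ V) (_ ∷ W) (suc i) v at-i off-i =
  cong₂ _∷_ (off-i zero) (insertAt-unique V W i v at-i (off-i ∘ suc))

⁅⁆≡insertAt-⊥ : (x : Fin (suc n)) → ⁅ x ⁆ ≡ insertAt ⊥ x true
⁅⁆≡insertAt-⊥ zero = refl
⁅⁆≡insertAt-⊥ {suc n} (suc x) = cong (false ∷_) (⁅⁆≡insertAt-⊥ x)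

insertAt-⊥-false : (x : Fin (suc n)) → insertAt ⊥ x false ≡ ⊥
insertAt-⊥-false zero = refl
insertAt-⊥-false {suc n} (suc x) = cong (false ∷_) (insertAt-⊥-false x)

∪⁅⁆≡insertAt-removeAt : (B : Subset (suc n)) (x : Fin (suc n)) →
  B ∪ ⁅ x ⁆ ≡ insertAt (removeAt B x) x true
∪⁅⁆≡insertAt-removeAt (b ∷ B) zero = cong₂ _∷_ (∨-zeroʳ b) (∪-identityʳ B)
∪⁅⁆≡insertAt-removeAt (b ∷ B@(_ ∷ _)) (suc x) = cong₂ _∷_ (∨-identityʳ b) (∪⁅⁆≡insertAt-removeAt B x)

insertAt-∪-⁅punchIn⁆ : (A : Subset n) (x : Fin (suc n)) (v : Bool) (z : Fin n) →
  insertAt A x v ∪ ⁅ punchIn x z ⁆ ≡ insertAt (A ∪ ⁅ z ⁆) x v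
insertAt-∪-⁅punchIn⁆ A zero v z = cong (_∷ (A ∪ ⁅ z ⁆)) (∨-identityʳ v)
insertAt-∪-⁅punchIn⁆ (a ∷ A) (suc x) v zero =
  cong ((a ∨ true) ∷_) (trans (∪-identityʳ _) (cong (λ W → insertAt W x v) (sym (∪-identityʳ A))))
insertAt-∪-⁅punchIn⁆ (a ∷ A) (suc x) v (suc z) = cong ((a ∨ false) ∷_) (insertAt-∪-⁅punchIn⁆ A x v z)

insertAt-⊆ : {A B : Subset n} (x : Fin (suc n)) (v : Bool) → B ⊆ A → insertAt B x v ⊆ insertAt A x v
insertAt-⊆ zero v B⊆A = s⊆s B⊆A
insertAt-⊆ {A = _ ∷ _} {_ ∷ _} (suc x) v B⊆A here with B⊆A here
... | here = here
insertAt-⊆ {A = _ ∷ _} {_ ∷ _} (suc x) v B⊆A (there p) = there (insertAt-⊆ x v (drop-∷-⊆ B⊆A) p)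

insertAt-∈-∉ : {A B : Subset n} (x : Fin (suc n)) (v : Bool) {z : Fin (suc n)} →
  z ∈ insertAt B x v → z ∉ insertAt A x v → ∃[ z′ ] z ≡ punchIn x z′ × z′ ∈ B × z′ ∉ A
insertAt-∈-∉ zero v here z∉ = ⊥-elim (z∉ here)
insertAt-∈-∉ zero v (there z∈) z∉ = _ , refl , z∈ , z∉ ∘ there
insertAt-∈-∉ {A = _ ∷ _} {_ ∷ _} (suc x) v here z∉ = zero , refl , here , λ { here → z∉ here }
insertAt-∈-∉ {A = _ ∷ _} {_ ∷ _} (suc x) v (there z∈) z∉ with insertAt-∈-∉ x v z∈ (z∉ ∘ there)
... | z′ , refl , z′∈B , z′∉A = suc z′ , refl , there z′∈B , z′∉A ∘ drop-there

∣insertAt∣ : (A : Subset n) (x : Fin (suc n)) (v : Bool) → ∣ insertAt A x v ∣ ≡ ∣ v ∷ A ∣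
∣insertAt∣ A zero v = refl
∣insertAt∣ (true ∷ A) (suc x) true = cong suc (∣insertAt∣ A x true)
∣insertAt∣ (true ∷ A) (suc x) false = cong suc (∣insertAt∣ A x false)
∣insertAt∣ (false ∷ A) (suc x) v = ∣insertAt∣ A x v

insertAt-∣<∣ : {A B : Subset n} (x : Fin (suc n)) (v : Bool) →
  ∣ A ∣ < ∣ B ∣ → ∣ insertAt A x v ∣ < ∣ insertAt B x v ∣
insertAt-∣<∣ {A = A} {B} x v lt =
  subst₂ _<_ (sym (∣insertAt∣ A x v)) (sym (∣insertAt∣ B x v)) (∷-mono v lt)
  where
  ∷-mono : ∀ v → ∣ A ∣ < ∣ B ∣ → ∣ v ∷ A ∣ < ∣ v ∷ B ∣
  ∷-mono true = s≤s
  ∷-mono false lt = lt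

image-lookup : (σ : Permutation n m) (A : Subset n) (j : Fin m) →
  lookup (image σ A) j ≡ lookup A (σ ⟨$⟩ˡ j)
image-lookup σ A j = lookup∘tabulate _ j

image-insertAt : (σ : Permutation (suc n) (suc m)) (x : Fin (suc n)) (A : Subset n) (v : Bool) →
  image σ (insertAt A x v) ≡ insertAt (image (remove x σ) A) (σ ⟨$⟩ʳ x) v
image-insertAt σ x A v = insertAt-unique _ _ (σ ⟨$⟩ʳ x) v at-σx off-σx
  where
  at-σx : lookup (image σ (insertAt A x v)) (σ ⟨$⟩ʳ x) ≡ v
  at-σx = begin
    lookup (image σ (insertAt A x v)) (σ ⟨$⟩ʳ x) ≡⟨ image-lookup σ (insertAt A x v) (σ ⟨$⟩ʳ x) ⟩
    lookup (insertAt A x v) (σ ⟨$⟩ˡ (σ ⟨$⟩ʳ x))  ≡⟨ cong (lookup (insertAt A x v)) (inverseˡ σ) ⟩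
    lookup (insertAt A x v) x                     ≡⟨ insertAt-lookup A x v ⟩
    v                                             ∎
  off-σx : ∀ j → lookup (image σ (insertAt A x v)) (punchIn (σ ⟨$⟩ʳ x) j) ≡
                  lookup (image (remove x σ) A) j
  off-σx j = begin
    lookup (image σ (insertAt A x v)) (punchIn (σ ⟨$⟩ʳ x) j) ≡⟨ image-lookup σ (insertAt A x v) _ ⟩
    lookup (insertAt A x v) (σ ⟨$⟩ˡ punchIn (σ ⟨$⟩ʳ x) j)
      ≡⟨ cong (lookup (insertAt A x v)) (sym (punchIn-punchOut _)) ⟩
    lookup (insertAt A x v) (punchIn x (remove x σ ⟨$⟩ˡ j)) ≡⟨ insertAt-punchIn A x v _ ⟩
    lookup A (remove x σ ⟨$⟩ˡ j)                           ≡⟨ image-lookup (remove x σ) A j ⟨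
    lookup (image (remove x σ) A) j                         ∎

image-⊥ : (σ : Permutation n m) → image σ ⊥ ≡ ⊥
image-⊥ σ = Pointwise-≡⇒≡ (ext λ j →
  trans (image-lookup σ ⊥ j) (trans (lookup-replicate (σ ⟨$⟩ˡ j) false) (sym (lookup-replicate j false))))

image-id : (A : Subset n) → image Perm.id A ≡ A
image-id = tabulate∘lookup

image-∘ₚ : (σ : Permutation n m) (τ : Permutation m a) (A : Subset n) →
  image (σ ∘ₚ τ) A ≡ image τ (image σ A)
image-∘ₚ σ τ A = Pointwise-≡⇒≡ (ext λ j →
  trans (image-lookup (σ ∘ₚ τ) A j) (sym (trans (image-lookup τ (image σ A) j) (image-lookup σ A _))))

image-cast : .(e : n ≡ m) (A : Subset n) → image (cast-id e) A ≡ cast e A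
image-cast e A = Pointwise-≡⇒≡ (ext λ j → trans (image-lookup (cast-id e) A j) (sym (lookup-cast₁ e A j)))

-- M ∖ x is minor M x false, and for a nonloop x, M / x is minor M x true.
minor : RawM (suc n) → Fin (suc n) → Bool → RawM n
minor M x v A = M (insertAt A x v)

NonLoop : RawM (suc n) → Fin (suc n) → Set
NonLoop M x = Indep (minor M x true) ⊥

Coloop : RawM (suc n) → Fin (suc n) → Set
Coloop M x = ∀ A → Indep (minor M x false) A → Indep (minor M x true) A

NonLoop-down : {M : RawM (suc n)} {x : Fin (suc n)} (S : Subset n) →
  IsMatroid M → Indep (minor M x true) S → NonLoop M x
NonLoop-down {x = x} S matroid =
  IsMatroid.indep-down matroid _ _ (insertAt-⊆ x true (⊆-min S))

minor-isMatroid : {M : RawM (suc n)} {x : Fin (suc n)} {v : Bool} →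
  IsMatroid M → NonLoop M x → IsMatroid (minor M x v)
minor-isMatroid {M = M} {x} {v} matroid nonloop = record
  { indep-∅    = minor-indep-∅ v
  ; indep-down = λ A B B⊆A → indep-down (insertAt A x v) (insertAt B x v) (insertAt-⊆ x v B⊆A)
  ; indep-aug  = minor-indep-aug
  }
  where
  open IsMatroid matroid using (indep-down; indep-aug)
  minor-indep-∅ : ∀ v → Indep (minor M x v) ⊥
  minor-indep-∅ true  = nonloop
  minor-indep-∅ false = subst (Indep M) (sym (insertAt-⊥-false x)) (IsMatroid.indep-∅ matroid)
  minor-indep-aug : ∀ A B → Indep (minor M x v) A → Indep (minor M x v) B → ∣ A ∣ < ∣ B ∣ →
    ∃[ z ] (z ∈ B × z ∉ A × Indep (minor M x v) (A ∪ ⁅ z ⁆))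
  minor-indep-aug A B indepA indepB lt
    with indep-aug (insertAt A x v) (insertAt B x v) indepA indepB (insertAt-∣<∣ x v lt)
  ... | z , z∈B , z∉A , indep with insertAt-∈-∉ x v z∈B z∉A
  ... | z′ , refl , z′∈B , z′∉A =
    z′ , z′∈B , z′∉A , subst (Indep M) (insertAt-∪-⁅punchIn⁆ A x v z′) indep

Coloop-∪ : {M : RawM (suc n)} {x : Fin (suc n)} {B : Subset (suc n)} →
  Coloop M x → Indep M B → Indep M (B ∪ ⁅ x ⁆)
Coloop-∪ {M = M} {x} {B} coloop indep =
  subst (Indep M) (sym (∪⁅⁆≡insertAt-removeAt B x)) (add (lookup B x) (insertAt-removeAt B x))
  where
  add : ∀ b → insertAt (removeAt B x) x b ≡ B → Indep M (insertAt (removeAt B x) x true)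
  add true  B≡ = subst (Indep M) (sym B≡) indep
  add false B≡ = coloop _ (subst (Indep M) (sym B≡) indep)

basis-∋-Coloop : {M : RawM (suc n)} {x : Fin (suc n)} {B : Subset (suc n)} →
  Coloop M x → isBasis M B ≡ true → lookup B x ≡ true
basis-∋-Coloop {n} {M} {x} {B} coloop basis = begin
  lookup B x                        ≡⟨ ∨-identityʳ _ ⟨
  lookup B x ∨ not true             ≡⟨ cong (λ i → lookup B x ∨ not i) (Coloop-∪ {M = M} coloop indep) ⟨
  lookup B x ∨ not (M (B ∪ ⁅ x ⁆))  ≡⟨ maximal-at-x ⟩
  true                              ∎
  where
  indep : Indep M B
  indep = ∧-conicalˡ (M B) _ basis
  maximal-at-x : lookup B x ∨ not (M (B ∪ ⁅ x ⁆)) ≡ true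
  maximal-at-x = Equivalence.to T-≡
    (All.lookup (all⁺ addable-only-if-in-B (allFin _) (Equivalence.from T-≡ (∧-conicalʳ (M B) _ basis)))
                (∈-allFin x))
    where
    addable-only-if-in-B : Fin (suc n) → Bool
    addable-only-if-in-B y = lookup B y ∨ not (M (B ∪ ⁅ y ⁆))

Coloop⇒isColoop : {M : RawM (suc n)} {x : Fin (suc n)} → Coloop M x → isColoop M x ≡ true
Coloop⇒isColoop {M = M} {x} coloop =
  Equivalence.to T-≡ (all⁻ _ (All.universal in-every-basis (allSubsets _)))
  where
  in-every-basis : ∀ B → T (not (isBasis M B) ∨ lookup B x)
  in-every-basis B with isBasis M B in basis
  ... | false = _
  ... | true  = Equivalence.from T-≡ (basis-∋-Coloop {M = M} coloop basis)

isLoop≡false⇒NonLoop : (M : RawM (suc n)) (x : Fin (suc n)) → isLoop M x ≡ false → NonLoop M x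
isLoop≡false⇒NonLoop M x not-loop =
  subst (Indep M) (⁅⁆≡insertAt-⊥ x) (not-injective {y = true} not-loop)

isColoop≡false⇒¬Coloop : (M : RawM (suc n)) (x : Fin (suc n)) → isColoop M x ≡ false → ¬ Coloop M x
isColoop≡false⇒¬Coloop M x not-coloop coloop
  with () ← trans (sym not-coloop) (Coloop⇒isColoop {M = M} coloop)

contract≡minor : (M : RawM (suc n)) (x : Fin (suc n)) →
  isLoop M x ≡ false → contract M x ≡ minor M x true
contract≡minor M x =
  cong (λ loop A → if loop then M (insertAt A x false) else M (insertAt A x true))

module _ {M : RawM n} {M′ : RawM m} {σ : Permutation n m} (iso : IsIso M M′ σ) where

  IsIso-∘ₚ : {M″ : RawM a} {τ : Permutation m a} → IsIso M′ M″ τ → IsIso M M″ (σ ∘ₚ τ)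
  IsIso-∘ₚ {M″ = M″} {τ} iso′ A = trans (cong M″ (image-∘ₚ σ τ A)) (trans (iso′ (image σ A)) (iso A))

  Disconnected-iso : Disconnected M′ → Disconnected M
  Disconnected-iso (a , b , N₁ , N₂ , m₁ , m₂ , τ , iso′) =
    a , b , N₁ , N₂ , m₁ , m₂ , σ ∘ₚ τ , IsIso-∘ₚ {M″ = directSum N₁ N₂} {τ} iso′

IsIso-id : {M M′ : RawM n} → (∀ A → M′ A ≡ M A) → IsIso M M′ Perm.id
IsIso-id {M′ = M′} M′≗M A = trans (cong M′ (image-id A)) (M′≗M A)

IsIso-cast : {M : RawM n} {M′ : RawM m} .(e : n ≡ m) →
  (∀ A → M′ (cast e A) ≡ M A) → IsIso M M′ (cast-id e)
IsIso-cast {M′ = M′} e M′∘cast≗M A = trans (cong M′ (image-cast e A)) (M′∘cast≗M A)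

module MinorIso {M : RawM (suc n)} {M′ : RawM (suc m)} {σ : Permutation (suc n) (suc m)}
                (iso : IsIso M M′ σ) {x : Fin (suc n)} where

  minor-iso : ∀ {v} → IsIso (minor M x v) (minor M′ (σ ⟨$⟩ʳ x) v) (remove x σ)
  minor-iso {v} A = trans (cong M′ (sym (image-insertAt σ x A v))) (iso (insertAt A x v))

  NonLoop-iso : NonLoop M x → NonLoop M′ (σ ⟨$⟩ʳ x)
  NonLoop-iso nonloop =
    trans (cong (minor M′ (σ ⟨$⟩ʳ x) true) (sym (image-⊥ (remove x σ)))) (trans (minor-iso ⊥) nonloop)

  Coloop-iso : Coloop M′ (σ ⟨$⟩ʳ x) → Coloop M x
  Coloop-iso coloop A indep =
    trans (sym (minor-iso A)) (coloop (image (remove x σ) A) (trans (minor-iso A) indep))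

splitL-insertAt-↑ˡ : (A : Subset (a + b)) (y : Fin (suc a)) (v : Bool) →
  splitL {suc a} {b} (insertAt A (y ↑ˡ b) v) ≡ insertAt (splitL {a} {b} A) y v
splitL-insertAt-↑ˡ A zero v = refl
splitL-insertAt-↑ˡ {suc a} {b} (s ∷ A) (suc y) v = cong (s ∷_) (splitL-insertAt-↑ˡ {a} {b} A y v)

splitR-insertAt-↑ˡ : (A : Subset (a + b)) (y : Fin (suc a)) (v : Bool) →
  splitR {suc a} {b} (insertAt A (y ↑ˡ b) v) ≡ splitR {a} {b} A
splitR-insertAt-↑ˡ A zero v = refl
splitR-insertAt-↑ˡ {suc a} {b} (s ∷ A) (suc y) v = splitR-insertAt-↑ˡ {a} {b} A y v

splitL-insertAt-↑ʳ : .(e : a + suc b ≡ suc a + b) (A : Subset (a + suc b)) (y : Fin (suc b)) (v : Bool) →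
  splitL {suc a} {suc b} (insertAt A (suc a ↑ʳ y) v) ≡ splitL {suc a} {b} (cast e A)
splitL-insertAt-↑ʳ {zero} e (s ∷ A) y v = refl
splitL-insertAt-↑ʳ {suc a} {b} e (s ∷ A) y v =
  cong (s ∷_) (splitL-insertAt-↑ʳ {a} {b} (cong pred e) A y v)

splitR-insertAt-↑ʳ : .(e : a + suc b ≡ suc a + b) (A : Subset (a + suc b)) (y : Fin (suc b)) (v : Bool) →
  splitR {suc a} {suc b} (insertAt A (suc a ↑ʳ y) v) ≡ insertAt (splitR {suc a} {b} (cast e A)) y v
splitR-insertAt-↑ʳ {zero} e (s ∷ A) y v = cong (λ W → insertAt W y v) (sym (cast-is-id _ A))
splitR-insertAt-↑ʳ {suc a} {b} e (s ∷ A) y v = splitR-insertAt-↑ʳ {a} {b} (cong pred e) A y v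

module _ (N₁ : RawM (suc a)) (N₂ : RawM b) (y : Fin (suc a)) where

  minor-directSum-↑ˡ : ∀ {v} A → minor (directSum N₁ N₂) (y ↑ˡ b) v A ≡ directSum (minor N₁ y v) N₂ A
  minor-directSum-↑ˡ {v} A =
    cong₂ _∧_ (cong N₁ (splitL-insertAt-↑ˡ A y v)) (cong N₂ (splitR-insertAt-↑ˡ A y v))

  NonLoop-↑ˡ : IsMatroid N₁ → NonLoop (directSum N₁ N₂) (y ↑ˡ b) → NonLoop N₁ y
  NonLoop-↑ˡ matroid nonloop =
    NonLoop-down _ matroid (∧-conicalˡ _ _ (trans (sym (minor-directSum-↑ˡ ⊥)) nonloop))

  Coloop-↑ˡ : Coloop N₁ y → Coloop (directSum N₁ N₂) (y ↑ˡ b)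
  Coloop-↑ˡ coloop A indep =
    trans (minor-directSum-↑ˡ A) (cong₂ _∧_ (coloop _ (∧-conicalˡ _ _ indep′)) (∧-conicalʳ _ _ indep′))
    where indep′ = trans (sym (minor-directSum-↑ˡ A)) indep

module _ (N₁ : RawM (suc a)) (N₂ : RawM (suc b)) (y : Fin (suc b)) where

  minor-directSum-↑ʳ : ∀ {v} A →
    minor (directSum N₁ N₂) (suc a ↑ʳ y) v A ≡ directSum N₁ (minor N₂ y v) (cast (+-suc a b) A)
  minor-directSum-↑ʳ {v} A =
    cong₂ _∧_ (cong N₁ (splitL-insertAt-↑ʳ (+-suc a b) A y v))
              (cong N₂ (splitR-insertAt-↑ʳ (+-suc a b) A y v))

  NonLoop-↑ʳ : IsMatroid N₂ → NonLoop (directSum N₁ N₂) (suc a ↑ʳ y) → NonLoop N₂ y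
  NonLoop-↑ʳ matroid nonloop =
    NonLoop-down _ matroid (∧-conicalʳ _ _ (trans (sym (minor-directSum-↑ʳ ⊥)) nonloop))

  Coloop-↑ʳ : Coloop N₂ y → Coloop (directSum N₁ N₂) (suc a ↑ʳ y)
  Coloop-↑ʳ coloop A indep =
    trans (minor-directSum-↑ʳ A) (cong₂ _∧_ (∧-conicalˡ _ _ indep′) (coloop _ (∧-conicalʳ _ _ indep′)))
    where indep′ = trans (sym (minor-directSum-↑ʳ A)) indep

NonLoop⇒Coloop₁ : {N : RawM 1} → NonLoop N zero → Coloop N zero
NonLoop⇒Coloop₁ nonloop [] _ = nonloop

minor-directSum-↑ˡ-Disconnected : {N₁ : RawM (suc a)} {N₂ : RawM (suc b)} → IsMatroid N₁ → IsMatroid N₂ →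
  (y : Fin (suc a)) {v : Bool} →
  NonLoop (directSum N₁ N₂) (y ↑ˡ suc b) → ¬ Coloop (directSum N₁ N₂) (y ↑ˡ suc b) →
  Disconnected (minor (directSum N₁ N₂) (y ↑ˡ suc b) v)
minor-directSum-↑ˡ-Disconnected {zero} {N₁ = N₁} {N₂} m₁ m₂ zero nonloop ¬coloop =
  ⊥-elim (¬coloop (Coloop-↑ˡ N₁ N₂ zero (NonLoop⇒Coloop₁ {N₁} (NonLoop-↑ˡ N₁ N₂ zero m₁ nonloop))))
minor-directSum-↑ˡ-Disconnected {suc a} {b} {N₁} {N₂} m₁ m₂ y {v} nonloop _ =
  a , b , minor N₁ y v , N₂ , minor-isMatroid m₁ (NonLoop-↑ˡ N₁ N₂ y m₁ nonloop) , m₂ ,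
  Perm.id , IsIso-id {M′ = directSum (minor N₁ y v) N₂} (sym ∘ minor-directSum-↑ˡ N₁ N₂ y)

minor-directSum-↑ʳ-Disconnected : {N₁ : RawM (suc a)} {N₂ : RawM (suc b)} → IsMatroid N₁ → IsMatroid N₂ →
  (y : Fin (suc b)) {v : Bool} →
  NonLoop (directSum N₁ N₂) (suc a ↑ʳ y) → ¬ Coloop (directSum N₁ N₂) (suc a ↑ʳ y) →
  Disconnected (minor (directSum N₁ N₂) (suc a ↑ʳ y) v)
minor-directSum-↑ʳ-Disconnected {b = zero} {N₁} {N₂} m₁ m₂ zero nonloop ¬coloop =
  ⊥-elim (¬coloop (Coloop-↑ʳ N₁ N₂ zero (NonLoop⇒Coloop₁ {N₂} (NonLoop-↑ʳ N₁ N₂ zero m₂ nonloop))))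
minor-directSum-↑ʳ-Disconnected {a} {suc b} {N₁} {N₂} m₁ m₂ y {v} nonloop _ =
  a , b , N₁ , minor N₂ y v , m₁ , minor-isMatroid m₂ (NonLoop-↑ʳ N₁ N₂ y m₂ nonloop) ,
  cast-id (+-suc a (suc b)) ,
  IsIso-cast {M′ = directSum N₁ (minor N₂ y v)} (+-suc a (suc b)) (sym ∘ minor-directSum-↑ʳ N₁ N₂ y)

minor-directSum-Disconnected : {N₁ : RawM (suc a)} {N₂ : RawM (suc b)} → IsMatroid N₁ → IsMatroid N₂ →
  ∀ y {v} → NonLoop (directSum N₁ N₂) y → ¬ Coloop (directSum N₁ N₂) y →
  Disconnected (minor (directSum N₁ N₂) y v)
minor-directSum-Disconnected {a} {b} {N₁} {N₂} m₁ m₂ y {v} =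
  subst Goal (join-splitAt (suc a) (suc b) y) (by-summand (splitAt (suc a) y))
  where
  Goal : Fin (suc a + suc b) → Set
  Goal z = NonLoop (directSum N₁ N₂) z → ¬ Coloop (directSum N₁ N₂) z →
           Disconnected (minor (directSum N₁ N₂) z v)
  by-summand : ∀ s → Goal (join (suc a) (suc b) s)
  by-summand (inj₁ y₁) = minor-directSum-↑ˡ-Disconnected m₁ m₂ y₁
  by-summand (inj₂ y₂) = minor-directSum-↑ʳ-Disconnected m₁ m₂ y₂

minor-Disconnected : {M : RawM (suc n)} {x : Fin (suc n)} {v : Bool} →
  NonLoop M x → ¬ Coloop M x → Disconnected M → Disconnected (minor M x v)
minor-Disconnected {M = M} {x} nonloop ¬coloop (_ , _ , N₁ , N₂ , m₁ , m₂ , σ , iso) =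
  Disconnected-iso {σ = remove x σ} minor-iso
    (minor-directSum-Disconnected m₁ m₂ (σ ⟨$⟩ʳ x) (NonLoop-iso nonloop) (¬coloop ∘ Coloop-iso))
  where open MinorIso {M = M} {directSum N₁ N₂} {σ} iso {x}

module _ (P : Property) where

  PureDisc-concatMap : {h : ℚ × Gen → FSum} → (∀ q g → DiscGen P (q , g) → PureDisc P (h (q , g))) →
    ∀ {w} → PureDisc P w → PureDisc P (concatMap h w)
  PureDisc-concatMap h-pure pure = concat⁺ (map⁺ (All.map (h-pure _ _) pure))

  minor-Disc : (M : RawM (suc n)) (x : Fin (suc n)) {v : Bool} →
    IsMatroid M → Disconnected M → isLoop M x ≡ false → isColoop M x ≡ false → P (minor M x v) →
    IsMatroid (minor M x v) × Disconnected (minor M x v) × P (minor M x v)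
  minor-Disc M x matroid disconnected not-loop not-coloop P-minor =
    minor-isMatroid {x = x} matroid nonloop ,
    minor-Disconnected {x = x} nonloop (isColoop≡false⇒¬Coloop M x not-coloop) disconnected ,
    P-minor
    where nonloop = isLoop≡false⇒NonLoop M x not-loop

  ∂del-gen-PureDisc : DeletionClosed P → (∀ {n} (M : RawM n) → IsMatroid M → P M → Loopless M) →
    ∀ q g → DiscGen P (q , g) → PureDisc P (scale q (∂del-gen g))
  ∂del-gen-PureDisc closed loopless q (⟦_,_⟧ {zero} M η) _ = All.[]
  ∂del-gen-PureDisc closed loopless q (⟦_,_⟧ {suc n} M η) (matroid , disconnected , P-M) =
    map⁺ (map⁺ (All.map deletion (all-filter (λ x → not (isColoop M x) ≟ true) (allFin (suc n)))))
    where
    deletion : ∀ {x} → not (isColoop M x) ≡ true → DiscGen P (1ℚ , ⟦ delete M x , interior x η ⟧)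
    deletion {x} filtered = minor-Disc M x matroid disconnected
      (loopless M matroid P-M x) (not-injective {y = false} filtered) (closed M x matroid P-M)

  ∂con-gen-PureDisc : ContractionClosed P → (∀ {n} (M : RawM n) → IsMatroid M → P M → Coloopless M) →
    ∀ q g → DiscGen P (q , g) → PureDisc P (scale q (∂con-gen g))
  ∂con-gen-PureDisc closed coloopless q (⟦_,_⟧ {zero} M η) _ = All.[]
  ∂con-gen-PureDisc closed coloopless q (⟦_,_⟧ {suc n} M η) (matroid , disconnected , P-M) =
    map⁺ (map⁺ (All.map contraction (all-filter (λ x → not (isLoop M x) ≟ true) (allFin (suc n)))))
    where
    contraction : ∀ {x} → not (isLoop M x) ≡ true → DiscGen P (1ℚ , ⟦ contract M x , interior x η ⟧)
    contraction {x} filtered =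
      subst (λ N → IsMatroid N × Disconnected N × P N) (sym M/x≡)
        (minor-Disc M x matroid disconnected not-loop (coloopless M matroid P-M x)
          (subst P M/x≡ (closed M x matroid P-M)))
      where
      not-loop = not-injective {y = false} filtered
      M/x≡ = contract≡minor M x not-loop

  PureDisc-∂del : DeletionClosed P → (∀ {n} (M : RawM n) → IsMatroid M → P M → Loopless M) →
    ∀ {w} → PureDisc P w → PureDisc P (∂del w)
  PureDisc-∂del closed loopless = PureDisc-concatMap (∂del-gen-PureDisc closed loopless)

  PureDisc-∂con : ContractionClosed P → (∀ {n} (M : RawM n) → IsMatroid M → P M → Coloopless M) →
    ∀ {w} → PureDisc P w → PureDisc P (∂con w)
  PureDisc-∂con closed coloopless = PureDisc-concatMap (∂con-gen-PureDisc closed coloopless)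

lemma5p19 : (P : Property) → StableUnderIso P →
    (DeletionClosed P → (∀ {n} (M : RawM n) → IsMatroid M → P M → Loopless M) →
      ∀ w → PureDisc P w → InDisc P (∂del w))
    ×
    (ContractionClosed P → (∀ {n} (M : RawM n) → IsMatroid M → P M → Coloopless M) →
      ∀ w → PureDisc P w → InDisc P (∂con w))
lemma5p19 P _ =
  -- ∂ of a pure combination is already pure.
  (λ closed loopless w pure → ∂del w , PureDisc-∂del P closed loopless pure , ≈-refl) ,
  (λ closed coloopless w pure → ∂con w , PureDisc-∂con P closed coloopless pure , ≈-refl)
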